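{- Every nonempty finite set $A$ of integers is an asymptotic $(r,r+1)$-approximate group for every integer $r \geq 2$; that is, for every integer $r\ge 2$ there is $h_1$ such that for every integer $h \geq h_1$ there exists a set $X_h \subseteq \mathbb{Z}$ with $|X_h| \leq r+1$ and $r(hA) \subseteq X_h + hA$.
   Context: For nonempty subsets $A, X$ of $\mathbb{Z}$, $X+A=\{x+a : x\in X, a\in A\}$ and, for a positive integer $h$, $hA=\{a_1+\cdots+a_h : a_i \in A\}$. For positive integers $r,\ell$, a set $A$ is an $(r,\ell)$-approximate group if $A$ is nonempty and there exists a subset $X$ with $|X| \leq \ell$ and $rA \subseteq X + A$. A set $A$ is an asymptotic $(r,\ell)$-approximate group if $hA$ is an $(r,\ell)$-approximate group for every sufficiently large integer $h$. -}

module Defs where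

open import Data.Nat using (ℕ; zero; suc)
open import Data.Integer using (ℤ; 0ℤ; _+_)
open import Data.List using (List)
open import Data.List.Membership.Propositional using (_∈_)
open import Data.Product using (∃; ∃-syntax; _×_)
open import Relation.Binary.PropositionalEquality using (_≡_)



-- Finite sets of integers are represented by lists (duplicates allowed;
-- the underlying set is the set of list members).
toPred : List ℤ → ℤ → Set
toPred L z = z ∈ L

SumSet : ℕ → (ℤ → Set) → ℤ → Set
SumSet zero    S z = z ≡ 0ℤ
SumSet (suc h) S z = ∃[ s ] ∃[ t ] (S s × SumSet h S t × z ≡ s + t)

PlusSet : (ℤ → Set) → (ℤ → Set) → ℤ → Set
PlusSet X S z = ∃[ x ] ∃[ s ] (X x × S s × z ≡ x + s)

_⊆ℤ_ : (ℤ → Set) → (ℤ → Set) → Set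
P ⊆ℤ Q = ∀ z → P z → Q z

module Submission where

-- Let a = min A, b = max A and D = b − a.  Each e ∈ A satisfies the
-- barycentric identity  D·e = (b − e)·a + (e − a)·b, so (some positive
-- multiple ≤ D + 1 of) e can be traded for as many copies of a and b.
-- Hence every x ∈ N·A has a normal form  x = u·a + v·b + m  with
-- N = u + v + w and m ∈ w·A for a "remainder" size w ≤ K = |A|·D.
--
-- Now let r ≥ 1, h = K + L with L > (r − 1)·K, and n = (r − 1)·h.  An
-- x ∈ r(hA) = (rh)A in normal form has u + v ≥ n + L, so among the r + 1
-- "landmarks" n, 0, L, 2L, …, (r − 1)L there is a j with j ≤ u and
-- n − j ≤ v.  Peeling off the corner point j·a + (n − j)·b leaves an
-- element of hA, so r(hA) ⊆ X + hA for the r + 1 corner points X.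

open import Defs
open import Data.Nat as ℕ using (ℕ; zero; suc; _≤_; _≥_; NonZero; z≤n)
import Data.Nat.Properties as ℕP
open import Data.Nat.DivMod using (_/_; _%_; m≡m%n+[m/n]*n; m%n<n; m/n*n≤m; m<n*o⇒m/o<n)
import Data.Nat.Tactic.RingSolver as ℕSolver
open import Data.Integer as ℤ using (ℤ; 0ℤ; 1ℤ; +_; _+_; _*_; _-_; ∣_∣)
import Data.Integer.Properties as ℤP
open import Data.Integer.Tactic.RingSolver using (solve-∀)
open import Data.List using (List; []; _∷_; length; map; applyUpTo)
open import Data.List.Properties using (length-map; length-applyUpTo)
open import Data.List.Membership.Propositional using (_∈_)
open import Data.List.Membership.Propositional.Properties using (∈-map⁺; ∈-applyUpTo⁺)
open import Data.List.Relation.Unary.All as All using (All; []; _∷_)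
open import Data.List.Relation.Unary.Any using (here; there)
open import Data.List.Extrema ℤP.≤-totalOrder using (min; max; argmin-all; argmax-all; min≤⊤; min≤xs; ⊥≤max; xs≤max)
open import Data.Product using (∃-syntax; _×_; _,_)
open import Data.Empty using (⊥-elim)
open import Function using (id)
open import Relation.Nullary using (yes; no)
open import Relation.Binary.PropositionalEquality
  using (_≡_; _≢_; refl; sym; trans; cong; cong₂; subst; module ≡-Reasoning)

sumSet-+ : ∀ {S : ℤ → Set} p q {x y} → SumSet p S x → SumSet q S y → SumSet (p ℕ.+ q) S (x + y)
sumSet-+ zero    q refl Sy = subst (SumSet q _) (sym (ℤP.+-identityˡ _)) Sy
sumSet-+ (suc p) q {y = y} (s , t , Ss , St , refl) Sy =
  s , t + y , Ss , sumSet-+ p q St Sy , ℤP.+-assoc s t y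

sumSet-copies : ∀ {S : ℤ → Set} c {e} → S e → SumSet c S (+ c * e)
sumSet-copies zero        Se = refl
sumSet-copies (suc c) {e} Se = e , + c * e , Se , sumSet-copies c Se , ℤP.suc-* (+ c) e

sumSet-flatten : ∀ {S : ℤ → Set} r h → SumSet r (SumSet h S) ⊆ℤ SumSet (r ℕ.* h) S
sumSet-flatten zero    h _ refl = refl
sumSet-flatten (suc r) h _ (s , t , hs , rt , refl) = sumSet-+ h (r ℕ.* h) hs (sumSet-flatten r h t rt)

sumSet-mono : ∀ {S T : ℤ → Set} → S ⊆ℤ T → ∀ w → SumSet w S ⊆ℤ SumSet w T
sumSet-mono S⊆T zero    _ z≡0 = z≡0
sumSet-mono S⊆T (suc w) _ (s , t , Ss , St , eq) = s , t , S⊆T s Ss , sumSet-mono S⊆T w t St , eq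

sumSet-∷ : ∀ {e L} N {x} → SumSet N (toPred (e ∷ L)) x →
  ∃[ c ] ∃[ N' ] ∃[ y ] (N ≡ c ℕ.+ N' × SumSet N' (toPred L) y × x ≡ + c * e + y)
sumSet-∷ zero refl = 0 , 0 , 0ℤ , refl , refl , refl
sumSet-∷ (suc N) (s , t , here refl , St , refl) with sumSet-∷ N St
... | c , N' , y , refl , Sy , refl = suc c , N' , y , refl , Sy , one-more s (+ c) y
  where
  one-more : ∀ e C y → e + (C * e + y) ≡ (1ℤ + C) * e + y
  one-more = solve-∀
sumSet-∷ {e} (suc N) (s , t , there s∈L , St , refl) with sumSet-∷ N St
... | c , N' , y , refl , Sy , refl =
  c , suc N' , s + y , sym (ℕP.+-suc c N') , (s , y , s∈L , Sy , refl) , swap s (+ c * e) y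
  where
  swap : ∀ s z y → s + (z + y) ≡ z + (s + y)
  swap = solve-∀

min-∈ : ∀ x xs → min x xs ∈ x ∷ xs
min-∈ x xs = argmin-all id {P = _∈ x ∷ xs} (here refl) (All.tabulate there)

max-∈ : ∀ x xs → max x xs ∈ x ∷ xs
max-∈ x xs = argmax-all id {P = _∈ x ∷ xs} (here refl) (All.tabulate there)

between-extremes : ∀ x xs → All (λ e → min x xs ℤ.≤ e × e ℤ.≤ max x xs) (x ∷ xs)
between-extremes x xs = All.zip (min≤⊤ x xs ∷ min≤xs x xs , ⊥≤max x xs ∷ xs≤max x xs)

module Reduction (a b : ℤ) where

  D : ℕ
  D = ∣ b - a ∣

  InRange : ℤ → Set
  InRange e = a ℤ.≤ e × e ℤ.≤ b

  balance : ∀ {e} → a ℤ.≤ e → e ℤ.≤ b →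
    ∃[ p ] ∃[ q ] (p ℕ.+ q ≡ D × + D * e ≡ + p * a + + q * b)
  balance {e} a≤e e≤b = ∣ b - e ∣ , ∣ e - a ∣ , ℤP.+-injective counts , values
    where
    open ≡-Reasoning
    distance : ∀ {i j} → i ℤ.≤ j → + ∣ j - i ∣ ≡ j - i
    distance i≤j = ℤP.0≤i⇒+∣i∣≡i (ℤP.i≤j⇒0≤j-i i≤j)
    width : + D ≡ b - a
    width = distance (ℤP.≤-trans a≤e e≤b)
    telescope : ∀ a b e → (b - e) + (e - a) ≡ b - a
    telescope = solve-∀
    barycentre : ∀ a b e → (b - a) * e ≡ (b - e) * a + (e - a) * b
    barycentre = solve-∀
    counts : + ∣ b - e ∣ + + ∣ e - a ∣ ≡ + D
    counts = begin
      + ∣ b - e ∣ + + ∣ e - a ∣ ≡⟨ cong₂ _+_ (distance e≤b) (distance a≤e) ⟩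
      (b - e) + (e - a)         ≡⟨ telescope a b e ⟩
      b - a                     ≡⟨ sym width ⟩
      + D                       ∎
    values : + D * e ≡ + ∣ b - e ∣ * a + + ∣ e - a ∣ * b
    values = begin
      + D * e                           ≡⟨ cong (_* e) width ⟩
      (b - a) * e                       ≡⟨ barycentre a b e ⟩
      (b - e) * a + (e - a) * b         ≡⟨ sym (cong₂ (λ P Q → P * a + Q * b) (distance e≤b) (distance a≤e)) ⟩
      + ∣ b - e ∣ * a + + ∣ e - a ∣ * b ∎

  -- Exchange: for e ∈ [a, b] some positive multiple (suc k)·e with k ≤ D
  -- equals p·a + q·b with p + q = suc k.  (If D = 0 then e = a and k = 0.)
  exchange : ∀ {e} → a ℤ.≤ e → e ℤ.≤ b →
    ∃[ k ] (k ℕ.≤ D × ∃[ p ] ∃[ q ] (p ℕ.+ q ≡ suc k × + suc k * e ≡ + p * a + + q * b))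
  exchange {e} a≤e e≤b with D in D≡ | balance a≤e e≤b
  ... | suc k | p , q , p+q≡D , D·e≡ = k , ℕP.n≤1+n k , p , q , p+q≡D , D·e≡
  ... | zero  | _ = 0 , z≤n , 1 , 0 , refl , single
    where
    b≡a : b ≡ a
    b≡a = ℤP.i-j≡0⇒i≡j b a (ℤP.∣i∣≡0⇒i≡0 D≡)
    e≡a : e ≡ a
    e≡a = ℤP.≤-antisym (subst (e ℤ.≤_) b≡a e≤b) a≤e
    one-a : ∀ a b → + 1 * a ≡ + 1 * a + + 0 * b
    one-a = solve-∀
    single : + 1 * e ≡ + 1 * a + + 0 * b
    single = trans (cong (+ 1 *_) e≡a) (one-a a b)

  embed : ∀ m n o → + (m ℕ.+ n ℕ.* o) ≡ + m + + n * + o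
  embed m n o = trans (ℤP.pos-+ m (n ℕ.* o)) (cong (λ z → + m + z) (ℤP.pos-* n o))

  -- Bookkeeping of t trades: of c = c' + t·E copies of e, the t·E with
  -- E = p + q become t·p copies of a and t·q copies of b; c' stay.
  tradeCounts : ∀ c' t {c E p q} → c ≡ c' ℕ.+ t ℕ.* E → p ℕ.+ q ≡ E → ∀ u v w →
    c ℕ.+ (u ℕ.+ v ℕ.+ w) ≡ (u ℕ.+ t ℕ.* p) ℕ.+ (v ℕ.+ t ℕ.* q) ℕ.+ (c' ℕ.+ w)
  tradeCounts c' t {p = p} {q} refl refl u v w = regroup c' t p q u v w
    where
    regroup : ∀ c' t p q u v w →
      c' ℕ.+ t ℕ.* (p ℕ.+ q) ℕ.+ (u ℕ.+ v ℕ.+ w) ≡ (u ℕ.+ t ℕ.* p) ℕ.+ (v ℕ.+ t ℕ.* q) ℕ.+ (c' ℕ.+ w)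
    regroup = ℕSolver.solve-∀

  tradeValues : ∀ c' t {c E p q e} → c ≡ c' ℕ.+ t ℕ.* E → + E * e ≡ + p * a + + q * b → ∀ u v m →
    + c * e + (+ u * a + + v * b + m) ≡ + (u ℕ.+ t ℕ.* p) * a + + (v ℕ.+ t ℕ.* q) * b + (+ c' * e + m)
  tradeValues c' t {E = E} {p} {q} {e} refl trade u v m = begin
    + (c' ℕ.+ t ℕ.* E) * e + R                       ≡⟨ cong (λ C → C * e + R) (embed c' t E) ⟩
    (+ c' + + t * + E) * e + R                       ≡⟨ unfold (+ c') (+ t) (+ E) e R ⟩
    + c' * e + + t * (+ E * e) + R                   ≡⟨ cong (λ z → + c' * e + + t * z + R) trade ⟩
    + c' * e + + t * (+ p * a + + q * b) + R         ≡⟨ refold a b (+ c') (+ t) (+ p) (+ q) e (+ u) (+ v) m ⟩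
    (+ u + + t * + p) * a + (+ v + + t * + q) * b + (+ c' * e + m)
      ≡⟨ sym (cong₂ (λ U V → U * a + V * b + (+ c' * e + m)) (embed u t p) (embed v t q)) ⟩
    + (u ℕ.+ t ℕ.* p) * a + + (v ℕ.+ t ℕ.* q) * b + (+ c' * e + m) ∎
    where
    open ≡-Reasoning
    R = + u * a + + v * b + m
    unfold : ∀ C' T E e R → (C' + T * E) * e + R ≡ C' * e + T * (E * e) + R
    unfold = solve-∀
    refold : ∀ a b C' T P Q e U V m → C' * e + T * (P * a + Q * b) + (U * a + V * b + m)
                                     ≡ (U + T * P) * a + (V + T * Q) * b + (C' * e + m)
    refold = solve-∀

  -- By induction on L:
  -- the c copies of the head e are traded ⌊c / E⌋ times (E from exchange),
  -- leaving c mod E ≤ D copies in the remainder.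
  normalForm : ∀ L → All InRange L → ∀ N {x} → SumSet N (toPred L) x →
    ∃[ u ] ∃[ v ] ∃[ w ] ∃[ m ] (N ≡ u ℕ.+ v ℕ.+ w × w ℕ.≤ length L ℕ.* D ×
      SumSet w (toPred L) m × x ≡ + u * a + + v * b + m)
  normalForm []      []                  zero    refl = 0 , 0 , 0 , 0ℤ , refl , z≤n , refl , refl
  normalForm []      []                  (suc N) (_ , _ , () , _)
  normalForm (e ∷ L) ((a≤e , e≤b) ∷ L⊆) N Sx
    with sumSet-∷ N Sx
  ... | c , N' , y , refl , Sy , refl
    with normalForm L L⊆ N' Sy | exchange a≤e e≤b
  ... | u , v , w , m , refl , w≤ , Sm , refl | k , k≤D , p , q , p+q≡E , trade =
    u ℕ.+ t ℕ.* p , v ℕ.+ t ℕ.* q , c' ℕ.+ w , + c' * e + m ,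
    tradeCounts c' t c≡ p+q≡E u v w ,
    ℕP.+-mono-≤ c'≤D w≤ ,
    sumSet-+ c' w (sumSet-copies c' (here refl)) (sumSet-mono (λ _ → there) w m Sm) ,
    tradeValues c' t c≡ trade u v m
    where
    t c' : ℕ
    t = c / suc k
    c' = c % suc k
    c≡ : c ≡ c' ℕ.+ t ℕ.* suc k
    c≡ = m≡m%n+[m/n]*n c (suc k)
    c'≤D : c' ℕ.≤ D
    c'≤D = ℕP.≤-trans (ℕ.s≤s⁻¹ (m%n<n c (suc k))) k≤D

landmarks : ℕ → ℕ → ℕ → List ℕ
landmarks r L n = n ∷ applyUpTo (ℕ._* L) r

-- If n ≤ r·L and n + L ≤ u + v, some landmark j has j ≤ u, j ≤ n and
-- n − j ≤ v: take j = n if n ≤ u, and otherwise j = ⌊u / L⌋·L.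
landmark : ∀ r L n .{{_ : NonZero L}} u v → n ≤ r ℕ.* L → n ℕ.+ L ≤ u ℕ.+ v →
  ∃[ j ] (j ∈ landmarks r L n × j ≤ u × j ≤ n × n ℕ.∸ j ≤ v)
landmark r L n u v n≤rL n+L≤u+v with n ℕ.≤? u
... | yes n≤u = n , here refl , n≤u , ℕP.≤-refl , subst (_≤ v) (sym (ℕP.n∸n≡0 n)) z≤n
... | no  n≰u = j , there (∈-applyUpTo⁺ (ℕ._* L) (m<n*o⇒m/o<n u<rL)) , j≤u , ℕP.<⇒≤ j<n , n∸j≤v
  where
  open ℕP.≤-Reasoning
  j = u / L ℕ.* L
  swap : ∀ j L v → j ℕ.+ L ℕ.+ v ≡ j ℕ.+ v ℕ.+ L
  swap = ℕSolver.solve-∀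
  u<n : u ℕ.< n
  u<n = ℕP.≰⇒> n≰u
  u<rL : u ℕ.< r ℕ.* L
  u<rL = ℕP.<-≤-trans u<n n≤rL
  j≤u : j ≤ u
  j≤u = m/n*n≤m u L
  j<n : j ℕ.< n
  j<n = ℕP.≤-<-trans j≤u u<n
  u<j+L : u ℕ.< j ℕ.+ L
  u<j+L = begin-strict
    u              ≡⟨ m≡m%n+[m/n]*n u L ⟩
    u % L ℕ.+ j    <⟨ ℕP.+-monoˡ-< j (m%n<n u L) ⟩
    L ℕ.+ j        ≡⟨ ℕP.+-comm L j ⟩
    j ℕ.+ L        ∎
  n∸j≤v : n ℕ.∸ j ≤ v
  n∸j≤v = ℕP.m≤n+o⇒m∸n≤o n j (ℕP.<⇒≤ (ℕP.+-cancelʳ-< L n (j ℕ.+ v) (begin-strict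
    n ℕ.+ L          ≤⟨ n+L≤u+v ⟩
    u ℕ.+ v          <⟨ ℕP.+-monoˡ-< v u<j+L ⟩
    j ℕ.+ L ℕ.+ v    ≡⟨ swap j L v ⟩
    j ℕ.+ v ℕ.+ L    ∎)))

slack : ∀ {K L n u v w} → K ℕ.+ L ℕ.+ n ≡ u ℕ.+ v ℕ.+ w → w ≤ K → n ℕ.+ L ≤ u ℕ.+ v
slack {K} {L} {n} {u} {v} {w} counts w≤K = ℕP.+-cancelʳ-≤ w (n ℕ.+ L) (u ℕ.+ v) (begin
  n ℕ.+ L ℕ.+ w   ≤⟨ ℕP.+-monoʳ-≤ (n ℕ.+ L) w≤K ⟩
  n ℕ.+ L ℕ.+ K   ≡⟨ rotate n L K ⟩
  K ℕ.+ L ℕ.+ n   ≡⟨ counts ⟩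
  u ℕ.+ v ℕ.+ w   ∎)
  where
  open ℕP.≤-Reasoning
  rotate : ∀ n L K → n ℕ.+ L ℕ.+ K ≡ K ℕ.+ L ℕ.+ n
  rotate = ℕSolver.solve-∀

peelCount : ∀ {j n} → j ≤ n → ∀ h u' v' w →
  h ℕ.+ n ≡ j ℕ.+ u' ℕ.+ (n ℕ.∸ j ℕ.+ v') ℕ.+ w → u' ℕ.+ v' ℕ.+ w ≡ h
peelCount {j} j≤n h u' v' w counts with ℕP.m≤n⇒∃[o]m+o≡n j≤n
... | i , refl rewrite ℕP.m+n∸m≡n j i =
  ℕP.+-cancelʳ-≡ (j ℕ.+ i) (u' ℕ.+ v' ℕ.+ w) h (sym (trans counts (regroup j u' i v' w)))
  where
  regroup : ∀ j u' i v' w → j ℕ.+ u' ℕ.+ (i ℕ.+ v') ℕ.+ w ≡ u' ℕ.+ v' ℕ.+ w ℕ.+ (j ℕ.+ i)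
  regroup = ℕSolver.solve-∀

module Covering (A : List ℤ) {a b : ℤ} (a∈A : a ∈ A) (b∈A : b ∈ A)
                (A⊆[a,b] : All (Reduction.InRange a b) A) where

  open Reduction a b

  -- Bound on the remainder size in the normal form of elements of N·A.
  K : ℕ
  K = length A ℕ.* D

  peelCorner : ∀ j i u' v' m →
    + (j ℕ.+ u') * a + + (i ℕ.+ v') * b + m ≡ (+ j * a + + i * b) + (+ u' * a + + v' * b + m)
  peelCorner j i u' v' m = regroup a b (+ j) (+ u') (+ i) (+ v') m
    where
    regroup : ∀ a b J U I V m → (J + U) * a + (I + V) * b + m ≡ (J * a + I * b) + (U * a + V * b + m)
    regroup = solve-∀

  covering : ∀ r' L → r' ℕ.* K ℕ.< L →
    ∃[ X ] (length X ≤ suc (suc r') ×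
      SumSet (suc r') (SumSet (K ℕ.+ L) (toPred A)) ⊆ℤ PlusSet (toPred X) (SumSet (K ℕ.+ L) (toPred A)))
  covering r' L r'K<L = X , ℕP.≤-reflexive |X|≡ , cover
    where
    instance
      L≢0 : NonZero L
      L≢0 = ℕ.>-nonZero (ℕP.≤-<-trans z≤n r'K<L)
    h n : ℕ
    h = K ℕ.+ L
    n = r' ℕ.* h
    corner : ℕ → ℤ
    corner j = + j * a + + (n ℕ.∸ j) * b
    X : List ℤ
    X = map corner (landmarks (suc r') L n)
    |X|≡ : length X ≡ suc (suc r')
    |X|≡ = trans (length-map corner (landmarks (suc r') L n)) (cong suc (length-applyUpTo (ℕ._* L) (suc r')))
    n≤rL : n ≤ suc r' ℕ.* L
    n≤rL = begin
      r' ℕ.* (K ℕ.+ L)          ≡⟨ ℕP.*-distribˡ-+ r' K L ⟩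
      r' ℕ.* K ℕ.+ r' ℕ.* L     ≤⟨ ℕP.+-monoˡ-≤ (r' ℕ.* L) (ℕP.<⇒≤ r'K<L) ⟩
      L ℕ.+ r' ℕ.* L            ∎
      where open ℕP.≤-Reasoning
    cover : SumSet (suc r') (SumSet h (toPred A)) ⊆ℤ PlusSet (toPred X) (SumSet h (toPred A))
    cover x x∈ with normalForm A A⊆[a,b] (suc r' ℕ.* h) (sumSet-flatten (suc r') h x x∈)
    ... | u , v , w , m , counts , w≤K , Sm , refl
      with landmark (suc r') L n u v n≤rL (slack {u = u} {v = v} counts w≤K)
    ... | j , j∈ , j≤u , j≤n , n∸j≤v
      with ℕP.m≤n⇒∃[o]m+o≡n j≤u | ℕP.m≤n⇒∃[o]m+o≡n n∸j≤v
    ... | u' , refl | v' , refl =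
      corner j , + u' * a + + v' * b + m , ∈-map⁺ corner j∈ ,
      subst (λ k → SumSet k (toPred A) (+ u' * a + + v' * b + m)) (peelCount j≤n h u' v' w counts)
        (sumSet-+ (u' ℕ.+ v') w (sumSet-+ u' v' (sumSet-copies u' a∈A) (sumSet-copies v' b∈A)) Sm) ,
      peelCorner j (n ℕ.∸ j) u' v' m

mainTheorem4 : (A : List ℤ) → A ≢ [] → (r : ℕ) → r ≥ 2 →
    ∃[ h₁ ] ((h : ℕ) → h ≥ h₁ →
      ∃[ X ] (length X ≤ suc r ×
        SumSet r (SumSet h (toPred A)) ⊆ℤ PlusSet (toPred X) (SumSet h (toPred A))))
mainTheorem4 []       A≢[] _        _  = ⊥-elim (A≢[] refl)
mainTheorem4 _        _    zero     ()
mainTheorem4 (x ∷ xs) _    (suc r') _  = K ℕ.+ suc (r' ℕ.* K) , coverLarge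
  where
  -- The hypothesis r ≥ 2 only excludes r = 0; the argument works for r ≥ 1.
  open Covering (x ∷ xs) (min-∈ x xs) (max-∈ x xs) (between-extremes x xs)
  coverLarge : ∀ h → h ≥ K ℕ.+ suc (r' ℕ.* K) →
    ∃[ X ] (length X ≤ suc (suc r') ×
      SumSet (suc r') (SumSet h (toPred (x ∷ xs))) ⊆ℤ PlusSet (toPred X) (SumSet h (toPred (x ∷ xs))))
  coverLarge h h≥ with ℕP.m≤n⇒∃[o]m+o≡n (ℕP.≤-trans (ℕP.m≤m+n K _) h≥)
  ... | L , refl = covering r' L (ℕP.+-cancelˡ-≤ K _ _ h≥)
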